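{- Let $t$ be a possibilistic KB and let $I$ be a set of valuations with $t^v\subseteq I$. Suppose that for each $\alpha\in I$ there is an FO KB $k^*_\alpha$ with $k^*_\alpha\equiv t^*_\alpha$. Then $t\equiv\{(\varphi,\alpha)\mid \varphi\in k^*_\alpha,\ \alpha\in I\}$.
   Context: $L$ is a propositional or first-order language with classical semantics. A possibilistic formula is a pair $(\varphi,\alpha)$ with $\varphi\in L$ and $\alpha\in(0,1]$ a real number with finitely many decimal digits (a valuation); a possibilistic KB is a finite set of possibilistic formulas. For a set $\Omega$ of interpretations, a possibility distribution is $\pi:\Omega\to[0,1]$ with necessity $N(\varphi)=\inf\{1-\pi(\mathcal I)\mid\mathcal I\in\Omega,\ \mathcal I\models\neg\varphi\}$ ($\inf\emptyset=1$); $\pi$ satisfies $(\varphi,\alpha)$ iff $N(\varphi)\ge\alpha$ and satisfies a set of possibilistic formulas iff it satisfies each; a set $K$ entails $(\varphi,\alpha)$ iff every distribution satisfying $K$ satisfies $(\varphi,\alpha)$, and two such sets are equivalent ($\equiv$) iff they entail the same possibilistic formulas. For FO KBs (finite sets of formulas of $L$), $\equiv$ is classical logical equivalence. For a possibilistic KB $t$: $t^v=\{\alpha\mid(\varphi,\alpha)\in t\}$, the $\alpha$-cut is $t_\alpha=\{(\varphi,\beta)\in t\mid\beta\ge\alpha\}$, and $t^*_\alpha=\{\varphi\mid(\varphi,\beta)\in t_\alpha\}$ is its FO projection.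
   Formalization: Possibility distributions π take rational values in [0,1] rather than real values. -}

module Defs where

open import Data.Nat as ℕ using (ℕ; _^_)
open import Data.Nat.Divisibility using (_∣_)
open import Data.Rational using (ℚ; 0ℚ; 1ℚ; _≤_; _<_; _-_; ↧ₙ_)
open import Data.Rational.Properties using (_≤?_)
open import Data.Product using (Σ; ∃; _×_; _,_; proj₁; proj₂)
open import Data.List using (List; map; filter)
open import Data.List.Membership.Propositional using (_∈_)
open import Data.List.Relation.Unary.All using (All)
open import Function.Bundles using (_⇔_)
open import Relation.Nullary using (¬_)

record Logic : Set₁ where
  field
    Form   : Set
    Interp : Set
    _⊨_    : Interp → Form → Set
    neg    : Form → Form
    ⊨-neg  : ∀ I φ → (I ⊨ neg φ) ⇔ (¬ (I ⊨ φ))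

-- Valuations: rationals in (0,1] with finitely many decimal digits
-- (i.e. the reduced denominator divides some power of 10).
IsValuation : ℚ → Set
IsValuation α = (0ℚ < α) × (α ≤ 1ℚ) × ∃ λ n → (↧ₙ α) ∣ (10 ^ n)

module _ (L : Logic) where
  open Logic L

  PForm : Set
  PForm = Form × ℚ

  IsPKB : List PForm → Set
  IsPKB t = All (λ p → IsValuation (proj₂ p)) t

  PSet : Set₁
  PSet = PForm → Set

  toPSet : List PForm → PSet
  toPSet t p = p ∈ t

  record Distribution : Set where
    field
      π     : Interp → ℚ
      π-≥0  : ∀ I → 0ℚ ≤ π I
      π-≤1  : ∀ I → π I ≤ 1ℚ
  open Distribution public

  -- N(φ) ≥ α, with N(φ) = inf { 1 - π(I) | I ⊨ ¬φ }, unfolded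
  -- (an infimum is ≥ α iff every element is ≥ α; inf ∅ = 1 ≥ α).
  NecGeq : Distribution → Form → ℚ → Set
  NecGeq d φ α = ∀ I → I ⊨ neg φ → α ≤ (1ℚ - π d I)

  SatPF : Distribution → PForm → Set
  SatPF d (φ , α) = NecGeq d φ α

  SatSet : Distribution → PSet → Set
  SatSet d K = ∀ p → K p → SatPF d p

  Entails : PSet → PForm → Set
  Entails K p = ∀ d → SatSet d K → SatPF d p

  _≡ₚ_ : PSet → PSet → Set
  K ≡ₚ K' = ∀ φ α → IsValuation α → Entails K (φ , α) ⇔ Entails K' (φ , α)

  ModelOf : Interp → List Form → Set
  ModelOf I k = All (I ⊨_) k

  _≡FO_ : List Form → List Form → Set
  k ≡FO k' = ∀ I → ModelOf I k ⇔ ModelOf I k'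

  ValsIn : List PForm → (ℚ → Set) → Set
  ValsIn t I = ∀ φ α → (φ , α) ∈ t → I α

  cut : List PForm → ℚ → List PForm
  cut t α = filter (λ p → α ≤? proj₂ p) t

  cutStar : List PForm → ℚ → List Form
  cutStar t α = map proj₁ (cut t α)

  assemble : (ℚ → Set) → (ℚ → List Form) → PSet
  assemble I k (φ , α) = I α × φ ∈ k α

{-# OPTIONS --safe #-}
module Submission where

-- A distribution satisfies the formulas (φ , β), φ ∈ k, exactly when every
-- interpretation J with 1 - π(J) < β is a model of k.  This condition only
-- depends on k up to classical equivalence, and t is satisfied iff, for each
-- level β, its cut t*_β is satisfied at level β (necessity being monotone).
-- So t and the assembled set have the same satisfying distributions.  Since
-- ≤ on ℚ is decidable, the argument goes through constructively in the
-- double-negation monad.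

open import Defs
open import Level using (0ℓ)
open import Data.Rational using (ℚ; 1ℚ; _-_; _≤_)
open import Data.Rational.Properties using (_≤?_; ≤-trans; ≤-refl)
open import Data.List using (List)
open import Data.List.Membership.Propositional using (_∈_)
open import Data.List.Membership.Propositional.Properties using (∈-map⁺; ∈-map⁻; ∈-filter⁺; ∈-filter⁻)
open import Data.List.Relation.Unary.All using (lookup; tabulate; sequenceA)
open import Data.Product using (_,_; proj₁; proj₂)
open import Effect.Monad using (RawMonad)
open import Function.Bundles using (_⇔_; mk⇔; Equivalence)
open import Relation.Nullary using (¬_)
open import Relation.Nullary.Decidable using (decidable-stable)
open import Relation.Nullary.Negation using (¬¬-Monad; ¬¬-map)
open import Relation.Binary.PropositionalEquality using (refl)

module _ (L : Logic) where
  open Logic L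

  SatAtLevel : Distribution L → ℚ → List Form → Set
  SatAtLevel d β k = ∀ φ → φ ∈ k → SatPF L d (φ , β)

  NecGeq-antitone : ∀ d φ {β γ} → β ≤ γ → NecGeq L d φ γ → NecGeq L d φ β
  NecGeq-antitone d φ β≤γ nec J J⊨¬φ = ≤-trans β≤γ (nec J J⊨¬φ)

  SatPF-byContradiction : ∀ d φ β →
    (∀ J → ¬ β ≤ (1ℚ - π d J) → ¬ ¬ J ⊨ φ) → SatPF L d (φ , β)
  SatPF-byContradiction d φ β h J J⊨¬φ =
    decidable-stable (β ≤? (1ℚ - π d J)) λ β≰ →
      h J β≰ (Equivalence.to (⊨-neg J φ) J⊨¬φ)

  SatAtLevel⇒¬¬ModelOf : ∀ d β k J → SatAtLevel d β k →
    ¬ β ≤ (1ℚ - π d J) → ¬ ¬ ModelOf L J k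
  SatAtLevel⇒¬¬ModelOf d β k J sat β≰ =
    sequenceA 0ℓ (RawMonad.rawApplicative ¬¬-Monad) (tabulate J⊨¬¬φ)
    where
    J⊨¬¬φ : ∀ {φ} → φ ∈ k → ¬ ¬ J ⊨ φ
    J⊨¬¬φ {φ} φ∈k J⊭φ = β≰ (sat φ φ∈k J (Equivalence.from (⊨-neg J φ) J⊭φ))

  SatAtLevel-entailed : ∀ d β {k k'} → (∀ J → ModelOf L J k → ModelOf L J k') →
    SatAtLevel d β k → SatAtLevel d β k'
  SatAtLevel-entailed d β {k} k⊨k' sat φ φ∈k' =
    SatPF-byContradiction d φ β λ J β≰ →
      ¬¬-map (λ J⊨k → lookup (k⊨k' J J⊨k) φ∈k') (SatAtLevel⇒¬¬ModelOf d β k J sat β≰)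

  SatSet⇒SatAtLevel-cutStar : ∀ d t → SatSet L d (toPSet L t) →
    ∀ β → SatAtLevel d β (cutStar L t β)
  SatSet⇒SatAtLevel-cutStar d t sat β φ φ∈t*β with ∈-map⁻ proj₁ φ∈t*β
  ... | (φ , γ) , φγ∈tβ , refl with ∈-filter⁻ (λ p → β ≤? proj₂ p) φγ∈tβ
  ... | φγ∈t , β≤γ = NecGeq-antitone d φ β≤γ (sat (φ , γ) φγ∈t)

  SatAtLevel-cutStar⇒SatSet : ∀ d t (I : ℚ → Set) → ValsIn L t I →
    (∀ β → I β → SatAtLevel d β (cutStar L t β)) → SatSet L d (toPSet L t)
  SatAtLevel-cutStar⇒SatSet d t I vals sat (φ , β) φβ∈t =
    sat β (vals φ β φβ∈t) φ (∈-map⁺ proj₁ (∈-filter⁺ (λ p → β ≤? proj₂ p) φβ∈t ≤-refl))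

  sameSatisfiers⇒≡ₚ : ∀ {K K'} → (∀ d → SatSet L d K ⇔ SatSet L d K') → _≡ₚ_ L K K'
  sameSatisfiers⇒≡ₚ K⇔K' φ α _ =
    mk⇔ (λ K⊨ d sat' → K⊨ d (Equivalence.from (K⇔K' d) sat'))
        (λ K'⊨ d sat → K'⊨ d (Equivalence.to (K⇔K' d) sat))

lemma2 : (L : Logic) (t : List (PForm L)) → IsPKB L t →
    (I : ℚ → Set) → (∀ α → I α → IsValuation α) → ValsIn L t I →
    (k : ℚ → List (Logic.Form L)) →
    (∀ α → I α → _≡FO_ L (k α) (cutStar L t α)) →
    _≡ₚ_ L (toPSet L t) (assemble L I k)
lemma2 L t _ I _ vals k k≡t* = sameSatisfiers⇒≡ₚ L λ d → mk⇔
  (λ sat (φ , β) (Iβ , φ∈kβ) →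
     SatAtLevel-entailed L d β (λ J → Equivalence.from (k≡t* β Iβ J))
       (SatSet⇒SatAtLevel-cutStar L d t sat β) φ φ∈kβ)
  (λ sat → SatAtLevel-cutStar⇒SatSet L d t I vals λ β Iβ →
     SatAtLevel-entailed L d β (λ J → Equivalence.to (k≡t* β Iβ J))
       (λ φ φ∈kβ → sat (φ , β) (Iβ , φ∈kβ)))
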